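{- Let $\pi$ be an integer array of length $n$, and define the binary word $x_\pi$ of length $n$ by $x_\pi[i] = 0$ if $\pi[i] = i-1$ and $x_\pi[i] = 1$ otherwise ($1 \le i \le n$). If $\pi = \pi_x$ for some binary word $x$ of length $n$, then $\pi = \pi_{x_\pi}$.
   Context: For a binary word $w$ over $\{0,1\}$, $ones(w)$ denotes the number of $1$'s in $w$. Two binary words of equal length are abelian equivalent if they have the same number of $1$'s. An abelian border of a binary word $w$ is a proper prefix of $w$ (a prefix different from $w$, possibly empty) that is abelian equivalent to the proper suffix of $w$ of the same length. For a binary word $x$ of length $n$, the abelian border array $\pi_x$ is the array of length $n$ with $\pi_x[i]$ ($1\le i\le n$) equal to the length of the longest abelian border of the prefix $x[1\cdots i]$. -}

module Defs where

open import Data.Bool using (Bool; true; false; if_then_else_)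
open import Data.Nat using (ℕ; zero; suc; _+_; _∸_; _≟_)
open import Data.Integer using (ℤ; +_)
open import Data.List using (List; []; _∷_; take; drop; length)
open import Data.Vec using (Vec; toList; tabulate)
open import Data.Fin using (Fin; toℕ)
open import Relation.Nullary using (yes; no)
open import Relation.Binary.PropositionalEquality using (_≡_)

-- Binary words: true = letter 1, false = letter 0.

ones : List Bool → ℕ
ones [] = 0
ones (true ∷ w) = suc (ones w)
ones (false ∷ w) = ones w

prefix : ℕ → List Bool → List Bool
prefix l w = take l w

suffix : ℕ → List Bool → List Bool
suffix l w = drop (length w ∸ l) w

-- The prefix of length l is an abelian border of w (for l < |w|):
-- same number of 1's as the suffix of length l.
-- Search for the longest abelian border of length ≤ l (l = 0 always works).
longestUpTo : List Bool → ℕ → ℕ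
longestUpTo w zero = 0
longestUpTo w (suc l) with ones (prefix (suc l) w) ≟ ones (suffix (suc l) w)
... | yes _ = suc l
... | no  _ = longestUpTo w l

longestAbelianBorder : List Bool → ℕ
longestAbelianBorder [] = 0
longestAbelianBorder w@(_ ∷ _) = longestUpTo w (length w ∸ 1)

-- abelian border array, 0-indexed: entry k corresponds to paper's π_x[k+1]
-- = longest abelian border of the prefix x[1..k+1]
abelianBorderArray : {n : ℕ} → Vec Bool n → Fin n → ℕ
abelianBorderArray x k = longestAbelianBorder (take (suc (toℕ k)) (toList x))

-- x_π : x_π[i] = 0 iff π[i] = i - 1 (1-based), i.e. π[k] = k (0-based)
xOf : {n : ℕ} → (Fin n → ℤ) → Vec Bool n
xOf {n} π = tabulate λ k → isOne (π k) (toℕ k)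
  where
  isOne : ℤ → ℕ → Bool
  isOne (+ m) j with m ≟ j
  ... | yes _ = false
  ... | no  _ = true
  isOne _ _ = true

{-# OPTIONS --safe #-}
-- For k ≥ 1 the prefix x[1..k+1] has an abelian border of the maximal length k exactly when
-- x[1] = x[k+1], since x[1..k] and x[2..k+1] share the factor x[2..k]. Since
-- π[1] = 0 always, x_π is x with every letter xor-ed with x[1]: either x or its complement.
-- Complementing a word preserves every abelian border, hence π_{x_π} = π_x = π.
module Submission where

open import Defs
open import Data.Bool using (Bool; true; false; not; _xor_)
open import Data.Bool.Properties using (xor-same) renaming (_≟_ to _≟ᵇ_)
open import Data.Fin using (Fin; toℕ) renaming (zero to fzero; suc to fsuc)
open import Data.Integer using (ℤ; +_)
open import Data.List using (List; []; _∷_; _++_; _∷ʳ_; [_]; take; drop; length; map)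
open import Data.List.Properties using (length-++; length-take; length-drop; length-map; take-map; drop-map; map-id)
open import Data.Nat using (ℕ; zero; suc; _+_; _∸_; _⊓_; _≟_)
open import Data.Nat.Properties using (+-comm; +-suc; +-cancelˡ-≡; +-cancelʳ-≡; m+n∸m≡n; m+n∸n≡m; m⊓n+n∸m≡n; <-irrefl; m≤n⇒m≤1+n; ≤-refl)
open import Data.Nat.Base using (_≤_; z≤n; s≤s)
open import Data.Product using (∃; _,_)
open import Data.Vec using (Vec; _∷_; toList; tabulate; lookup; head)
import Data.Vec as Vec
open import Data.Vec.Properties using (lookup∘tabulate; tabulate∘lookup; tabulate-cong; lookup-map; toList-map)
open import Data.Empty using (⊥-elim)
open import Function.Bundles using (_⇔_; mk⇔; Equivalence)
open import Function.Construct.Symmetry using (⇔-sym)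
open import Function.Construct.Composition using (_⇔-∘_)
open import Function.Base using (_∋_)
open import Relation.Nullary using (yes; no; does)
open import Relation.Nullary.Decidable using (does-⇔)
open import Relation.Binary.PropositionalEquality using (_≡_; refl; sym; trans; cong; module ≡-Reasoning)

AbelianBorder : List Bool → ℕ → Set
AbelianBorder w l = ones (prefix l w) ≡ ones (suffix l w)

ones-++ : ∀ u v → ones (u ++ v) ≡ ones u + ones v
ones-++ [] v = refl
ones-++ (true ∷ u) v = cong suc (ones-++ u v)
ones-++ (false ∷ u) v = ones-++ u v

ones-[]-injective : ∀ {a b} → ones [ a ] ≡ ones [ b ] → a ≡ b
ones-[]-injective {true} {true} _ = refl
ones-[]-injective {false} {false} _ = refl

longestUpTo-≤ : ∀ w l → longestUpTo w l ≤ l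
longestUpTo-≤ w zero = z≤n
longestUpTo-≤ w (suc l) with ones (prefix (suc l) w) ≟ ones (suffix (suc l) w)
... | yes _ = ≤-refl
... | no _ = m≤n⇒m≤1+n (longestUpTo-≤ w l)

longestUpTo-suc≡suc⇔ : ∀ w l → longestUpTo w (suc l) ≡ suc l ⇔ AbelianBorder w (suc l)
longestUpTo-suc≡suc⇔ w l with ones (prefix (suc l) w) ≟ ones (suffix (suc l) w)
... | yes border = mk⇔ (λ _ → border) (λ _ → refl)
... | no ¬border = mk⇔ (λ eq → ⊥-elim (<-irrefl eq (s≤s (longestUpTo-≤ w l)))) (λ border → ⊥-elim (¬border border))

longestUpTo-cong : ∀ {u v} → (∀ l → AbelianBorder u l ⇔ AbelianBorder v l) → ∀ l → longestUpTo u l ≡ longestUpTo v l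
longestUpTo-cong u⇔v zero = refl
longestUpTo-cong {u} {v} u⇔v (suc l)
  with ones (prefix (suc l) u) ≟ ones (suffix (suc l) u) | ones (prefix (suc l) v) ≟ ones (suffix (suc l) v)
... | yes _ | yes _ = refl
... | yes bu | no ¬bv = ⊥-elim (¬bv (Equivalence.to (u⇔v (suc l)) bu))
... | no ¬bu | yes bv = ⊥-elim (¬bu (Equivalence.from (u⇔v (suc l)) bv))
... | no _ | no _ = longestUpTo-cong u⇔v l

take-length-++ : ∀ {A : Set} (u v : List A) → take (length u) (u ++ v) ≡ u
take-length-++ [] v = refl
take-length-++ (a ∷ u) v = cong (a ∷_) (take-length-++ u v)

length-∷ʳ : ∀ {A : Set} (w : List A) b → length (w ∷ʳ b) ≡ suc (length w)
length-∷ʳ w b = trans (length-++ w) (+-comm (length w) 1)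

AbelianBorder-maximal⇔ : ∀ a w b → AbelianBorder (a ∷ w ∷ʳ b) (suc (length w)) ⇔ a ≡ b
AbelianBorder-maximal⇔ a w b rewrite take-length-++ w [ b ] | length-++ w {[ b ]} | m+n∸m≡n (length w) 1 =
  mk⇔ (λ border → ones-[]-injective (+-cancelʳ-≡ (ones w) _ _ (begin
        ones [ a ] + ones w   ≡⟨ ones-++ [ a ] w ⟨
        ones (a ∷ w)          ≡⟨ border ⟩
        ones (w ∷ʳ b)         ≡⟨ ones-++ w [ b ] ⟩
        ones w + ones [ b ]   ≡⟨ +-comm (ones w) _ ⟩
        ones [ b ] + ones w   ∎)))
      (λ { refl → trans (ones-++ [ a ] w) (trans (+-comm (ones [ a ]) (ones w)) (sym (ones-++ w [ a ]))) })
  where open ≡-Reasoning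

longestAbelianBorder-maximal⇔ : ∀ a w b {n} → length w ≡ n → longestAbelianBorder (a ∷ w ∷ʳ b) ≡ suc n ⇔ a ≡ b
longestAbelianBorder-maximal⇔ a w b refl rewrite length-∷ʳ w b =
  AbelianBorder-maximal⇔ a w b ⇔-∘ longestUpTo-suc≡suc⇔ (a ∷ w ∷ʳ b) (length w)

take-suc-toList : ∀ {n} (x : Vec Bool n) (k : Fin n) → take (suc (toℕ k)) (toList x) ≡ take (toℕ k) (toList x) ∷ʳ lookup x k
take-suc-toList (a ∷ x) fzero = refl
take-suc-toList (a ∷ x) (fsuc k) = cong (a ∷_) (take-suc-toList x k)

length-take-toList : ∀ {n} (x : Vec Bool n) (k : Fin n) → length (take (toℕ k) (toList x)) ≡ toℕ k
length-take-toList (a ∷ x) fzero = refl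
length-take-toList (a ∷ x) (fsuc k) = cong suc (length-take-toList x k)

abelianBorderArray-fsuc⇔ : ∀ {n} a (x : Vec Bool n) k → abelianBorderArray (a ∷ x) (fsuc k) ≡ suc (toℕ k) ⇔ a ≡ lookup x k
abelianBorderArray-fsuc⇔ a x k rewrite take-suc-toList x k =
  longestAbelianBorder-maximal⇔ a (take (toℕ k) (toList x)) (lookup x k) (length-take-toList x k)

ones-map-not : ∀ w → ones (map not w) + ones w ≡ length w
ones-map-not [] = refl
ones-map-not (true ∷ w) = trans (+-suc (ones (map not w)) (ones w)) (cong suc (ones-map-not w))
ones-map-not (false ∷ w) = cong suc (ones-map-not w)

m∸[m∸n]≡n⊓m : ∀ m n → m ∸ (m ∸ n) ≡ n ⊓ m
m∸[m∸n]≡n⊓m m n = trans (cong (_∸ (m ∸ n)) (sym (m⊓n+n∸m≡n n m))) (m+n∸n≡m (n ⊓ m) (m ∸ n))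

length-prefix≡length-suffix : ∀ l w → length (prefix l w) ≡ length (suffix l w)
length-prefix≡length-suffix l w = begin
  length (take l w)                    ≡⟨ length-take l w ⟩
  l ⊓ length w                         ≡⟨ m∸[m∸n]≡n⊓m (length w) l ⟨
  length w ∸ (length w ∸ l)            ≡⟨ length-drop (length w ∸ l) w ⟨
  length (drop (length w ∸ l) w)       ∎
  where open ≡-Reasoning

ones-map-not-≡⇔ : ∀ u v → length u ≡ length v → ones u ≡ ones v ⇔ ones (map not u) ≡ ones (map not v)
ones-map-not-≡⇔ u v |u|≡|v| = mk⇔
  (λ eq → +-cancelʳ-≡ (ones u) _ _ (trans total (cong (λ c → ones (map not v) + c) (sym eq))))
  (λ eq → +-cancelˡ-≡ (ones (map not u)) _ _ (trans total (cong (_+ ones v) (sym eq))))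
  where
  total : ones (map not u) + ones u ≡ ones (map not v) + ones v
  total = trans (ones-map-not u) (trans |u|≡|v| (sym (ones-map-not v)))

prefix-map : ∀ {f : Bool → Bool} l w → prefix l (map f w) ≡ map f (prefix l w)
prefix-map l w = take-map l w

suffix-map : ∀ {f : Bool → Bool} l w → suffix l (map f w) ≡ map f (suffix l w)
suffix-map {f} l w rewrite length-map f w = drop-map (length w ∸ l) w

AbelianBorder-map-not⇔ : ∀ w l → AbelianBorder (map not w) l ⇔ AbelianBorder w l
AbelianBorder-map-not⇔ w l rewrite prefix-map {not} l w | suffix-map {not} l w =
  ⇔-sym (ones-map-not-≡⇔ (prefix l w) (suffix l w) (length-prefix≡length-suffix l w))

longestAbelianBorder-map-not : ∀ w → longestAbelianBorder (map not w) ≡ longestAbelianBorder w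
longestAbelianBorder-map-not [] = refl
longestAbelianBorder-map-not (b ∷ w) rewrite length-map not w =
  longestUpTo-cong (AbelianBorder-map-not⇔ (b ∷ w)) (length w)

abelianBorderArray-map-xor : ∀ {n} c (x : Vec Bool n) k → abelianBorderArray (Vec.map (c xor_) x) k ≡ abelianBorderArray x k
abelianBorderArray-map-xor c x k = begin
  longestAbelianBorder (take (suc (toℕ k)) (toList (Vec.map (c xor_) x)))
    ≡⟨ cong (λ w → longestAbelianBorder (take (suc (toℕ k)) w)) (toList-map (c xor_) x) ⟩
  longestAbelianBorder (take (suc (toℕ k)) (map (c xor_) (toList x)))
    ≡⟨ cong longestAbelianBorder (take-map (suc (toℕ k)) (toList x)) ⟩
  longestAbelianBorder (map (c xor_) (take (suc (toℕ k)) (toList x)))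
    ≡⟨ map-xor c (take (suc (toℕ k)) (toList x)) ⟩
  longestAbelianBorder (take (suc (toℕ k)) (toList x)) ∎
  where
  open ≡-Reasoning
  map-xor : ∀ c w → longestAbelianBorder (map (c xor_) w) ≡ longestAbelianBorder w
  map-xor true w = longestAbelianBorder-map-not w
  map-xor false w = cong longestAbelianBorder (map-id w)

lookup-xOf : ∀ {n} (π : Fin n → ℤ) k {m} → π k ≡ + m → lookup (xOf π) k ≡ not (does (m ≟ toℕ k))
-- does (m ≟ toℕ k) normalises to m ≡ᵇ toℕ k, so the decision is recovered from m≟k rather than by rewriting.
lookup-xOf π k {m} π≡ rewrite (lookup (xOf π) k ≡ _ ∋ lookup∘tabulate _ k) | π≡ with m ≟ toℕ k in m≟k
... | yes _ = cong (λ d → not (does d)) (sym m≟k)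
... | no _ = cong (λ d → not (does d)) (sym m≟k)

not-does-≟ : ∀ a b → not (does (a ≟ᵇ b)) ≡ a xor b
not-does-≟ false false = refl
not-does-≟ false true = refl
not-does-≟ true false = refl
not-does-≟ true true = refl

xOf-abelianBorderArray : ∀ {n} (π : Fin (suc n) → ℤ) (x : Vec Bool (suc n)) →
  (∀ k → π k ≡ + abelianBorderArray x k) → xOf π ≡ Vec.map (head x xor_) x
xOf-abelianBorderArray π x@(a ∷ xs) π≡ = begin
  xOf π                                    ≡⟨ tabulate∘lookup (xOf π) ⟨
  tabulate (lookup (xOf π))                ≡⟨ tabulate-cong pointwise ⟩
  tabulate (lookup (Vec.map (a xor_) x))   ≡⟨ tabulate∘lookup _ ⟩
  Vec.map (a xor_) x                       ∎
  where
  open ≡-Reasoning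
  pointwise : ∀ k → lookup (xOf π) k ≡ lookup (Vec.map (a xor_) x) k
  pointwise fzero = trans (lookup-xOf π fzero (π≡ fzero)) (sym (xor-same a))
  pointwise (fsuc k) = begin
    lookup (xOf π) (fsuc k)                                         ≡⟨ lookup-xOf π (fsuc k) (π≡ (fsuc k)) ⟩
    not (does (abelianBorderArray x (fsuc k) ≟ suc (toℕ k)))        ≡⟨ cong not border≡head ⟩
    not (does (a ≟ᵇ lookup xs k))                                    ≡⟨ not-does-≟ a (lookup xs k) ⟩
    a xor lookup xs k                                               ≡⟨ lookup-map k (a xor_) xs ⟨
    lookup (Vec.map (a xor_) x) (fsuc k)                            ∎
    where
    border≡head : does (abelianBorderArray x (fsuc k) ≟ suc (toℕ k)) ≡ does (a ≟ᵇ lookup xs k)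
    border≡head = does-⇔ (abelianBorderArray-fsuc⇔ a xs k) (abelianBorderArray x (fsuc k) ≟ suc (toℕ k)) (a ≟ᵇ lookup xs k)

mainTheorem8 : (n : ℕ) (π : Fin n → ℤ) →
    (∃ λ (x : Vec Bool n) → ∀ k → π k ≡ + abelianBorderArray x k) →
    ∀ k → π k ≡ + abelianBorderArray (xOf π) k
mainTheorem8 zero π _ ()
mainTheorem8 (suc n) π (x , π≡) k = begin
  π k                                                     ≡⟨ π≡ k ⟩
  + abelianBorderArray x k                                ≡⟨ cong +_ (abelianBorderArray-map-xor (head x) x k) ⟨
  + abelianBorderArray (Vec.map (head x xor_) x) k        ≡⟨ cong (λ y → + abelianBorderArray y k) (xOf-abelianBorderArray π x π≡) ⟨
  + abelianBorderArray (xOf π) k                          ∎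
  where open ≡-Reasoning
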